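{- Let $J$ be an IMV-algebra. For $u,v\in J$ define $u\boldsymbol\wedge v=\neg(\neg u\odot v)\odot v$ and $u\boldsymbol\vee v=\neg(\neg u\oplus v)\oplus v$. For $x,y\in J$ let $x\sqcap y$ (resp. $x\sqcup y$) be the unique element of $J$ with $\gamma_J(x\sqcap y)=[\Delta x\wedge\Delta y,\ \nabla x\wedge\nabla y]$ (resp. $\gamma_J(x\sqcup y)=[\Delta x\vee\Delta y,\ \nabla x\vee\nabla y]$), where $\wedge,\vee$ are the lattice operations of the MV-algebra $\mathcal C(J)$. Then: (i) on $C(J)$ the operations $\boldsymbol\wedge,\boldsymbol\vee$ coincide with the lattice operations $\wedge,\vee$ of $\mathcal C(J)$; (ii) $(J,0,1,\sqcup,\sqcap)$ is a distributive lattice with largest element $1$ and smallest element $0$; (iii) denoting by $\sqsubseteq$ its lattice order, $\oplus$ and $\odot$ are monotone in both arguments, $\neg$ is order-reversing, and $\Delta x\sqsubseteq x\sqsubseteq\nabla x$ for all $x$; (iv) with $\zeta(u,v)=\Delta u\oplus(\iota\odot\nabla v\odot\neg\Delta u)$, if $u,v\in C(J)$ and $u\sqsubseteq v$, then $\Delta\zeta(u,v)=u$ and $\nabla\zeta(u,v)=v$, i.e. $\gamma_J(\zeta(u,v))=[u,v]$; (v) $x\sqcap y=\zeta(\Delta x\boldsymbol\wedge\Delta y,\ \nabla x\boldsymbol\wedge\nabla y)$ for all $x,y\in J$; (vi) $x\sqcup y=\zeta(\Delta x\boldsymbol\vee\Delta y,\ \nabla x\boldsymbol\vee\nabla y)$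 for all $x,y\in J$; (vii) for all $x,y\in J$: $x\sqsubseteq y$ iff $x\sqcup y=y$ iff $(\neg\Delta x\oplus\Delta y)\odot(\neg\nabla x\oplus\nabla y)=1$.
   Context: An IMV-algebra is an algebra $J=(J,0,1,\iota,\neg,\Delta,\nabla,\oplus,\odot)$ of type $(0,0,0,1,1,1,2,2)$ satisfying the equations: $x\oplus(y\oplus z)=(x\oplus y)\oplus z$; $x\oplus y=y\oplus x$; $x\oplus 0=x$; $x\oplus\neg 0=\neg 0$; $\neg\neg x=x$; $\neg(\neg\Delta x\oplus\Delta y)\oplus\Delta y=\neg(\neg\Delta y\oplus\Delta x)\oplus\Delta x$; $x\odot y=\neg(\neg x\oplus\neg y)$; $1=\neg 0$; $\nabla x=\neg\Delta\neg x$; $\neg\iota=\iota$; $\Delta 0=0$; $\Delta 1=1$; $\Delta\iota=0$; $\Delta\Delta x=\Delta x$; $\Delta\nabla x=\nabla x$; $\Delta(x\oplus y)=\Delta x\oplus\Delta y$; $\Delta(x\odot y)=\Delta x\odot\Delta y$; $\Delta x\odot\neg\nabla x=0$; $\Delta x\oplus(\iota\odot\nabla x\odot\neg\Delta x)=x$. The center is $C(J)=\{x\in J\mid\Delta x=\nabla x\}$; $\mathcal C(J)=(C(J),0,1,\neg,\oplus,\odot)$ is an MV-algebra, with natural order $\leq$ and lattice operations $\wedge,\vee$. For an MV-algebra $A$, $\mathcal I(A)$ is its algebra of intervals $[\alpha,\beta]$ ($\alpha\leq\beta$) with $0=[0,0]$, $1=[1,1]$, $\iota=A$, pointwise $\neg,\odot$,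 Minkowski $\oplus$, $\Delta[\alpha,\beta]=[\alpha,\alpha]$, $\nabla[\alpha,\beta]=[\beta,\beta]$. The map $\gamma_J\colon J\to\mathcal I(\mathcal C(J))$, $\gamma_J(x)=[\Delta x,\nabla x]$, is an isomorphism of IMV-algebras (so $J$ is identified with $\mathcal I(\mathcal C(J))$, and $x\sqcap y$, $x\sqcup y$ are well defined). -}

module Defs where

open import Relation.Binary.PropositionalEquality using (_≡_)
open import Data.Product using (_×_)
open import Function.Bundles using (_⇔_)


record IMVAlgebra : Set₁ where
  infixl 6 _⊕_
  infixl 7 _⊙_
  field
    Carrier : Set
    𝟘 𝟙 ι   : Carrier
    ¬_ Δ ∇  : Carrier → Carrier
    _⊕_ _⊙_ : Carrier → Carrier → Carrier
    ⊕-assoc : ∀ x y z → x ⊕ (y ⊕ z) ≡ (x ⊕ y) ⊕ z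
    ⊕-comm  : ∀ x y → x ⊕ y ≡ y ⊕ x
    ⊕-zero  : ∀ x → x ⊕ 𝟘 ≡ x
    ⊕-abs   : ∀ x → x ⊕ (¬ 𝟘) ≡ ¬ 𝟘
    ¬¬      : ∀ x → ¬ (¬ x) ≡ x
    luk     : ∀ x y → ¬ ((¬ (Δ x)) ⊕ Δ y) ⊕ Δ y ≡ ¬ ((¬ (Δ y)) ⊕ Δ x) ⊕ Δ x
    ⊙-def   : ∀ x y → x ⊙ y ≡ ¬ ((¬ x) ⊕ (¬ y))
    𝟙-def   : 𝟙 ≡ ¬ 𝟘
    ∇-def   : ∀ x → ∇ x ≡ ¬ (Δ (¬ x))
    ¬ι      : ¬ ι ≡ ι
    Δ𝟘      : Δ 𝟘 ≡ 𝟘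
    Δ𝟙      : Δ 𝟙 ≡ 𝟙
    Δι      : Δ ι ≡ 𝟘
    ΔΔ      : ∀ x → Δ (Δ x) ≡ Δ x
    Δ∇      : ∀ x → Δ (∇ x) ≡ ∇ x
    Δ⊕      : ∀ x y → Δ (x ⊕ y) ≡ Δ x ⊕ Δ y
    Δ⊙      : ∀ x y → Δ (x ⊙ y) ≡ Δ x ⊙ Δ y
    Δ⊙¬∇    : ∀ x → Δ x ⊙ (¬ (∇ x)) ≡ 𝟘
    decomp  : ∀ x → Δ x ⊕ ((ι ⊙ ∇ x) ⊙ (¬ (Δ x))) ≡ x

module IMV (J : IMVAlgebra) where
  open IMVAlgebra J
  open import Algebra.Lattice.Structures {A = Carrier} _≡_ using (IsDistributiveLattice)

  InCenter : Carrier → Set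
  InCenter x = Δ x ≡ ∇ x

  -- lattice operations of the MV-algebra 𝒞(J) (Cignoli–D'Ottaviano–Mundici):
  -- x ∨ y = ¬(¬x ⊕ y) ⊕ y ,  x ∧ y = ¬(¬x ∨ ¬y).
  -- 𝒞(J) is a subalgebra of (J,0,1,¬,⊕,⊙), so these are computed in J and
  -- only ever applied to central elements.
  _∨ᶜ_ : Carrier → Carrier → Carrier
  x ∨ᶜ y = (¬ ((¬ x) ⊕ y)) ⊕ y

  _∧ᶜ_ : Carrier → Carrier → Carrier
  x ∧ᶜ y = ¬ ((¬ x) ∨ᶜ (¬ y))

  _𝐰_ : Carrier → Carrier → Carrier
  u 𝐰 v = (¬ ((¬ u) ⊙ v)) ⊙ v

  _𝐯_ : Carrier → Carrier → Carrier
  u 𝐯 v = (¬ ((¬ u) ⊕ v)) ⊕ v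

  ζ : Carrier → Carrier → Carrier
  ζ u v = Δ u ⊕ ((ι ⊙ ∇ v) ⊙ (¬ (Δ u)))

  -- γ_J(z) = [Δz, ∇z]; "γ_J(z) = [a,b]" means Δz = a and ∇z = b.
  γ≡ : Carrier → Carrier → Carrier → Set
  γ≡ z a b = (Δ z ≡ a) × (∇ z ≡ b)

  -- ⊓ and ⊔ are the (unique, since γ_J is injective) operations with
  -- γ_J(x⊓y) = [Δx∧Δy, ∇x∧∇y], γ_J(x⊔y) = [Δx∨Δy, ∇x∨∇y].
  IsMeetOp : (Carrier → Carrier → Carrier) → Set
  IsMeetOp _⊓_ = ∀ x y → γ≡ (x ⊓ y) (Δ x ∧ᶜ Δ y) (∇ x ∧ᶜ ∇ y)

  IsJoinOp : (Carrier → Carrier → Carrier) → Set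
  IsJoinOp _⊔_ = ∀ x y → γ≡ (x ⊔ y) (Δ x ∨ᶜ Δ y) (∇ x ∨ᶜ ∇ y)

  record Prop53 (_⊓_ _⊔_ : Carrier → Carrier → Carrier) : Set where
    _⊑_ : Carrier → Carrier → Set
    x ⊑ y = x ⊓ y ≡ x
    field
      i-meet : ∀ u v → InCenter u → InCenter v → u 𝐰 v ≡ u ∧ᶜ v
      i-join : ∀ u v → InCenter u → InCenter v → u 𝐯 v ≡ u ∨ᶜ v
      ii-distrib : IsDistributiveLattice _⊔_ _⊓_
      ii-top     : ∀ x → x ⊑ 𝟙
      ii-bot     : ∀ x → 𝟘 ⊑ x
      iii-⊕-mono : ∀ x x′ y y′ → x ⊑ x′ → y ⊑ y′ → (x ⊕ y) ⊑ (x′ ⊕ y′)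
      iii-⊙-mono : ∀ x x′ y y′ → x ⊑ x′ → y ⊑ y′ → (x ⊙ y) ⊑ (x′ ⊙ y′)
      iii-¬-anti : ∀ x y → x ⊑ y → (¬ y) ⊑ (¬ x)
      iii-Δ      : ∀ x → Δ x ⊑ x
      iii-∇      : ∀ x → x ⊑ ∇ x
      iv : ∀ u v → InCenter u → InCenter v → u ⊑ v → γ≡ (ζ u v) u v
      v  : ∀ x y → x ⊓ y ≡ ζ (Δ x 𝐰 Δ y) (∇ x 𝐰 ∇ y)
      vi : ∀ x y → x ⊔ y ≡ ζ (Δ x 𝐯 Δ y) (∇ x 𝐯 ∇ y)
      vii-1 : ∀ x y → (x ⊑ y) ⇔ (x ⊔ y ≡ y)
      vii-2 : ∀ x y → (x ⊔ y ≡ y) ⇔ ((((¬ (Δ x)) ⊕ Δ y) ⊙ ((¬ (∇ x)) ⊕ ∇ y)) ≡ 𝟙)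

-- γ_J identifies J with the intervals [a, b] of the MV-algebra 𝒞(J), and ⊓, ⊔ act on the two
-- endpoints separately.  Hence γ_J embeds (J, ⊔, ⊓) into the lattice 𝒞(J) × 𝒞(J), which is
-- distributive because the lattice of an MV-algebra is (by prelinearity, (¬x ⊕ y) ∨ (¬y ⊕ x) = 1),
-- and the order of J is the endpointwise order.  Since Δ and ∇ are homomorphisms onto 𝒞(J)
-- (with Δ¬ = ¬∇), monotonicity transfers from 𝒞(J).  Finally γ_J(ζ(u, v)) = [u, v] for u ≤ v,
-- so the formulas for ⊓ and ⊔ follow from injectivity of γ_J.

module Submission where

open import Defs
open import Level using (Level)
open import Data.Product.Base using (Σ; _×_; _,_; proj₁; proj₂; zip′)
open import Data.Product.Relation.Binary.Pointwise.NonDependent using (Pointwise; ×-isEquivalence)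
open import Function.Bundles using (_⇔_; mk⇔; Equivalence)
open import Function.Construct.Composition using (_⇔-∘_)
open import Function.Construct.Symmetry using (⇔-sym)
open import Relation.Binary.Core using (Rel)
open import Relation.Binary.PropositionalEquality
  using (_≡_; refl; sym; trans; cong; cong₂; subst; subst₂; isEquivalence; module ≡-Reasoning)
open import Relation.Binary.Structures using (IsPartialOrder)
open import Axiom.UniquenessOfIdentityProofs.WithK using (uip)
open import Algebra.Core using (Op₂)
open import Algebra.Bundles using (CommutativeSemigroup)
import Algebra.Properties.CommutativeSemigroup as CommutativeSemigroupProperties
open import Algebra.Lattice.Structures using (IsLattice; IsDistributiveLattice)
open import Algebra.Lattice.Morphism.Structures using (IsLatticeMonomorphism)
import Algebra.Lattice.Morphism.LatticeMonomorphism as LatticeMonomorphism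
import Relation.Binary.Lattice as Order
import Relation.Binary.Lattice.Properties.Lattice as OrderLatticeProperties
import Relation.Binary.Lattice.Properties.DistributiveLattice as OrderDistributiveLatticeProperties
import Relation.Binary.Lattice.Properties.JoinSemilattice as JoinSemilatticeProperties
import Relation.Binary.Lattice.Properties.MeetSemilattice as MeetSemilatticeProperties

private
  variable
    a b ℓ₁ ℓ₂ : Level
    A B : Set a

isAlgDistributiveLattice : (L : Order.DistributiveLattice a ℓ₁ ℓ₂) →
  let open Order.DistributiveLattice L in IsDistributiveLattice _≈_ _∨_ _∧_
isAlgDistributiveLattice L = record
  { isLattice   = OrderLatticeProperties.isAlgLattice lattice
  ; ∨-distrib-∧ = OrderDistributiveLatticeProperties.∨-distrib-∧ L
  ; ∧-distrib-∨ = OrderDistributiveLatticeProperties.∧-distrib-∨ L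
  } where open Order.DistributiveLattice L

×-isDistributiveLattice : {_≈₁_ : Rel A ℓ₁} {_≈₂_ : Rel B ℓ₂} {_∨₁_ _∧₁_ : Op₂ A} {_∨₂_ _∧₂_ : Op₂ B} →
  IsDistributiveLattice _≈₁_ _∨₁_ _∧₁_ → IsDistributiveLattice _≈₂_ _∨₂_ _∧₂_ →
  IsDistributiveLattice (Pointwise _≈₁_ _≈₂_) (zip′ _∨₁_ _∨₂_) (zip′ _∧₁_ _∧₂_)
×-isDistributiveLattice L M = record
  { isLattice = record
    { isEquivalence = ×-isEquivalence L.isEquivalence M.isEquivalence
    ; ∨-comm        = λ (x₁ , x₂) (y₁ , y₂) → L.∨-comm x₁ y₁ , M.∨-comm x₂ y₂
    ; ∨-assoc       = λ (x₁ , x₂) (y₁ , y₂) (z₁ , z₂) → L.∨-assoc x₁ y₁ z₁ , M.∨-assoc x₂ y₂ z₂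
    ; ∨-cong        = λ (p₁ , p₂) (q₁ , q₂) → L.∨-cong p₁ q₁ , M.∨-cong p₂ q₂
    ; ∧-comm        = λ (x₁ , x₂) (y₁ , y₂) → L.∧-comm x₁ y₁ , M.∧-comm x₂ y₂
    ; ∧-assoc       = λ (x₁ , x₂) (y₁ , y₂) (z₁ , z₂) → L.∧-assoc x₁ y₁ z₁ , M.∧-assoc x₂ y₂ z₂
    ; ∧-cong        = λ (p₁ , p₂) (q₁ , q₂) → L.∧-cong p₁ q₁ , M.∧-cong p₂ q₂
    ; absorptive    = (λ (x₁ , x₂) (y₁ , y₂) → L.∨-absorbs-∧ x₁ y₁ , M.∨-absorbs-∧ x₂ y₂)
                    , (λ (x₁ , x₂) (y₁ , y₂) → L.∧-absorbs-∨ x₁ y₁ , M.∧-absorbs-∨ x₂ y₂)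
    }
  ; ∨-distrib-∧ = (λ (x₁ , x₂) (y₁ , y₂) (z₁ , z₂) → L.∨-distribˡ-∧ x₁ y₁ z₁ , M.∨-distribˡ-∧ x₂ y₂ z₂)
                , (λ (x₁ , x₂) (y₁ , y₂) (z₁ , z₂) → L.∨-distribʳ-∧ x₁ y₁ z₁ , M.∨-distribʳ-∧ x₂ y₂ z₂)
  ; ∧-distrib-∨ = (λ (x₁ , x₂) (y₁ , y₂) (z₁ , z₂) → L.∧-distribˡ-∨ x₁ y₁ z₁ , M.∧-distribˡ-∨ x₂ y₂ z₂)
                , (λ (x₁ , x₂) (y₁ , y₂) (z₁ , z₂) → L.∧-distribʳ-∨ x₁ y₁ z₁ , M.∧-distribʳ-∨ x₂ y₂ z₂)
  } where module L = IsDistributiveLattice L; module M = IsDistributiveLattice M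

∧≡⇔∨≡ : {_∨_ _∧_ : Op₂ A} → IsLattice _≡_ _∨_ _∧_ → ∀ {x y} → (x ∧ y ≡ x) ⇔ (x ∨ y ≡ y)
∧≡⇔∨≡ {_∨_ = _∨_} {_∧_} L {x} {y} = mk⇔ to from
  where
  open IsLattice L using (∨-comm; ∧-comm; ∨-absorbs-∧; ∧-absorbs-∨)
  open ≡-Reasoning
  to : x ∧ y ≡ x → x ∨ y ≡ y
  to e = begin
    x ∨ y        ≡⟨ cong (_∨ y) e ⟨
    (x ∧ y) ∨ y  ≡⟨ ∨-comm _ y ⟩
    y ∨ (x ∧ y)  ≡⟨ cong (y ∨_) (∧-comm x y) ⟩
    y ∨ (y ∧ x)  ≡⟨ ∨-absorbs-∧ y x ⟩
    y            ∎
  from : x ∨ y ≡ y → x ∧ y ≡ x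
  from e = begin
    x ∧ y        ≡⟨ cong (x ∧_) e ⟨
    x ∧ (x ∨ y)  ≡⟨ ∧-absorbs-∨ x y ⟩
    x            ∎

record MVAlgebra : Set₁ where
  infixl 6 _⊕_
  infix  8 ¬_
  field
    Carrier      : Set
    𝟘            : Carrier
    ¬_           : Carrier → Carrier
    _⊕_          : Carrier → Carrier → Carrier
    ⊕-assoc      : ∀ x y z → (x ⊕ y) ⊕ z ≡ x ⊕ (y ⊕ z)
    ⊕-comm       : ∀ x y → x ⊕ y ≡ y ⊕ x
    ⊕-identityʳ  : ∀ x → x ⊕ 𝟘 ≡ x
    ⊕-zeroʳ      : ∀ x → x ⊕ ¬ 𝟘 ≡ ¬ 𝟘
    ¬-involutive : ∀ x → ¬ ¬ x ≡ x
    łukasiewicz  : ∀ x y → ¬ (¬ x ⊕ y) ⊕ y ≡ ¬ (¬ y ⊕ x) ⊕ x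

module MVAlgebraProperties (A : MVAlgebra) where
  open MVAlgebra A public
  open ≡-Reasoning

  infixl 7 _⊙_
  infixl 7 _⊖_
  infixr 5 _∨_
  infixr 6 _∧_
  infix  4 _≤_

  𝟙 : Carrier
  𝟙 = ¬ 𝟘

  _⊙_ : Carrier → Carrier → Carrier
  x ⊙ y = ¬ (¬ x ⊕ ¬ y)

  -- x ⊖ y = x ⊙ ¬ y, written without the double negation.
  _⊖_ : Carrier → Carrier → Carrier
  x ⊖ y = ¬ (¬ x ⊕ y)

  _∨_ : Carrier → Carrier → Carrier
  x ∨ y = x ⊖ y ⊕ y

  _∧_ : Carrier → Carrier → Carrier
  x ∧ y = ¬ (¬ x ∨ ¬ y)

  _≤_ : Carrier → Carrier → Set
  x ≤ y = ¬ x ⊕ y ≡ 𝟙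

  ⊕-commutativeSemigroup : CommutativeSemigroup _ _
  ⊕-commutativeSemigroup = record
    { _≈_ = _≡_
    ; _∙_ = _⊕_
    ; isCommutativeSemigroup = record
      { isSemigroup = record
        { isMagma = record { isEquivalence = isEquivalence ; ∙-cong = cong₂ _⊕_ }
        ; assoc   = ⊕-assoc
        }
      ; comm = ⊕-comm
      }
    }

  open CommutativeSemigroupProperties ⊕-commutativeSemigroup using (x∙yz≈y∙xz)

  ⊕-identityˡ : ∀ x → 𝟘 ⊕ x ≡ x
  ⊕-identityˡ x = trans (⊕-comm 𝟘 x) (⊕-identityʳ x)

  ⊕-zeroˡ : ∀ x → 𝟙 ⊕ x ≡ 𝟙
  ⊕-zeroˡ x = trans (⊕-comm 𝟙 x) (⊕-zeroʳ x)

  ¬𝟙 : ¬ 𝟙 ≡ 𝟘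
  ¬𝟙 = ¬-involutive 𝟘

  ¬-injective : ∀ {x y} → ¬ x ≡ ¬ y → x ≡ y
  ¬-injective {x} {y} e = trans (sym (¬-involutive x)) (trans (cong ¬_ e) (¬-involutive y))

  ¬x⊕x≡𝟙 : ∀ x → ¬ x ⊕ x ≡ 𝟙
  ¬x⊕x≡𝟙 x = begin
    ¬ x ⊕ x              ≡⟨ cong (λ t → ¬ t ⊕ x) (⊕-identityˡ x) ⟨
    ¬ (𝟘 ⊕ x) ⊕ x        ≡⟨ cong (λ t → ¬ (t ⊕ x) ⊕ x) ¬𝟙 ⟨
    ¬ (¬ 𝟙 ⊕ x) ⊕ x      ≡⟨ łukasiewicz 𝟙 x ⟩
    ¬ (¬ x ⊕ 𝟙) ⊕ 𝟙      ≡⟨ ⊕-zeroʳ _ ⟩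
    𝟙                    ∎

  ⊙-comm : ∀ x y → x ⊙ y ≡ y ⊙ x
  ⊙-comm x y = cong ¬_ (⊕-comm (¬ x) (¬ y))

  ⊙-identityʳ : ∀ x → x ⊙ 𝟙 ≡ x
  ⊙-identityʳ x = trans (cong (λ t → ¬ (¬ x ⊕ t)) ¬𝟙) (trans (cong ¬_ (⊕-identityʳ (¬ x))) (¬-involutive x))

  ∨-comm : ∀ x y → x ∨ y ≡ y ∨ x
  ∨-comm = łukasiewicz

  ¬-∨ : ∀ x y → ¬ (x ∨ y) ≡ ¬ x ∧ ¬ y
  ¬-∨ x y = cong₂ (λ s t → ¬ (s ∨ t)) (sym (¬-involutive x)) (sym (¬-involutive y))

  x∧y≡y⊙[¬y⊕x] : ∀ x y → x ∧ y ≡ y ⊙ (¬ y ⊕ x)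
  x∧y≡y⊙[¬y⊕x] x y = cong ¬_ (begin
    ¬ (¬ ¬ x ⊕ ¬ y) ⊕ ¬ y  ≡⟨ cong (λ t → ¬ (t ⊕ ¬ y) ⊕ ¬ y) (¬-involutive x) ⟩
    ¬ (x ⊕ ¬ y) ⊕ ¬ y      ≡⟨ cong (λ t → ¬ t ⊕ ¬ y) (⊕-comm x (¬ y)) ⟩
    ¬ (¬ y ⊕ x) ⊕ ¬ y      ≡⟨ ⊕-comm _ _ ⟩
    ¬ y ⊕ ¬ (¬ y ⊕ x)      ∎)

  x⊙¬x≡𝟘 : ∀ x → x ⊙ ¬ x ≡ 𝟘
  x⊙¬x≡𝟘 x = trans (cong (λ t → ¬ (¬ x ⊕ t)) (¬-involutive x)) (trans (cong ¬_ (¬x⊕x≡𝟙 x)) ¬𝟙)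

  x≤x⊕y : ∀ x y → x ≤ x ⊕ y
  x≤x⊕y x y = begin
    ¬ x ⊕ (x ⊕ y)  ≡⟨ ⊕-assoc _ _ _ ⟨
    (¬ x ⊕ x) ⊕ y  ≡⟨ cong (_⊕ y) (¬x⊕x≡𝟙 x) ⟩
    𝟙 ⊕ y          ≡⟨ ⊕-zeroˡ y ⟩
    𝟙              ∎

  x≤y⇒x∨y≡y : ∀ {x y} → x ≤ y → x ∨ y ≡ y
  x≤y⇒x∨y≡y {x} {y} x≤y = trans (cong (λ t → ¬ t ⊕ y) x≤y) (trans (cong (_⊕ y) ¬𝟙) (⊕-identityˡ y))

  x≤y⇒y≡x⊕[y⊖x] : ∀ {x y} → x ≤ y → y ≡ x ⊕ (y ⊖ x)
  x≤y⇒y≡x⊕[y⊖x] {x} {y} x≤y = trans (sym (x≤y⇒x∨y≡y x≤y)) (trans (∨-comm x y) (⊕-comm _ _))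

  ≤-reflexive : ∀ {x y} → x ≡ y → x ≤ y
  ≤-reflexive {x} refl = ¬x⊕x≡𝟙 x

  ≤-trans : ∀ {x y z} → x ≤ y → y ≤ z → x ≤ z
  ≤-trans {x} {y} {z} x≤y y≤z = subst (x ≤_) (sym z≡x⊕w) (x≤x⊕y x _)
    where
    z≡x⊕w : z ≡ x ⊕ ((y ⊖ x) ⊕ (z ⊖ y))
    z≡x⊕w = begin
      z                          ≡⟨ x≤y⇒y≡x⊕[y⊖x] y≤z ⟩
      y ⊕ (z ⊖ y)                ≡⟨ cong (_⊕ (z ⊖ y)) (x≤y⇒y≡x⊕[y⊖x] x≤y) ⟩
      x ⊕ (y ⊖ x) ⊕ (z ⊖ y)      ≡⟨ ⊕-assoc _ _ _ ⟩
      x ⊕ ((y ⊖ x) ⊕ (z ⊖ y))    ∎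

  ≤-antisym : ∀ {x y} → x ≤ y → y ≤ x → x ≡ y
  ≤-antisym {x} {y} x≤y y≤x = trans (sym (x≤y⇒x∨y≡y y≤x)) (trans (∨-comm y x) (x≤y⇒x∨y≡y x≤y))

  ≤-isPartialOrder : IsPartialOrder _≡_ _≤_
  ≤-isPartialOrder = record
    { isPreorder = record { isEquivalence = isEquivalence ; reflexive = ≤-reflexive ; trans = ≤-trans }
    ; antisym    = ≤-antisym
    }

  x≤𝟙 : ∀ x → x ≤ 𝟙
  x≤𝟙 x = ⊕-zeroʳ (¬ x)

  𝟘≤x : ∀ x → 𝟘 ≤ x
  𝟘≤x x = ⊕-zeroˡ x

  ¬-mono-≤ : ∀ {x y} → x ≤ y → ¬ y ≤ ¬ x
  ¬-mono-≤ {x} {y} x≤y = trans (cong (_⊕ ¬ x) (¬-involutive y)) (trans (⊕-comm y (¬ x)) x≤y)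

  ¬-cancel-≤ : ∀ {x y} → ¬ x ≤ ¬ y → y ≤ x
  ¬-cancel-≤ {x} {y} ¬x≤¬y = subst₂ _≤_ (¬-involutive y) (¬-involutive x) (¬-mono-≤ ¬x≤¬y)

  x≤x∨y : ∀ x y → x ≤ x ∨ y
  x≤x∨y x y = subst (x ≤_) (trans (⊕-comm _ _) (∨-comm y x)) (x≤x⊕y x (y ⊖ x))

  y≤x∨y : ∀ x y → y ≤ x ∨ y
  y≤x∨y x y = subst (y ≤_) (⊕-comm y (x ⊖ y)) (x≤x⊕y y (x ⊖ y))

  ∨-least : ∀ {x y z} → x ≤ z → y ≤ z → x ∨ y ≤ z
  ∨-least {x} {y} {z} x≤z y≤z = begin
    ¬ (x ∨ y) ⊕ z              ≡⟨ cong (¬ (x ∨ y) ⊕_) z≡[z⊖y]⊕y ⟩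
    ¬ (x ∨ y) ⊕ (z ⊖ y ⊕ y)    ≡⟨ cong (¬ (x ∨ y) ⊕_) (⊕-comm _ y) ⟩
    ¬ (x ∨ y) ⊕ (y ⊕ z ⊖ y)    ≡⟨ ⊕-assoc _ _ _ ⟨
    ¬ (x ∨ y) ⊕ y ⊕ z ⊖ y      ≡⟨ cong (_⊕ (z ⊖ y)) ¬[x∨y]⊕y≡¬x⊕y ⟩
    ¬ x ⊕ y ⊕ z ⊖ y            ≡⟨ ⊕-assoc _ _ _ ⟩
    ¬ x ⊕ (y ⊕ z ⊖ y)          ≡⟨ cong (¬ x ⊕_) (trans (⊕-comm y _) (sym z≡[z⊖y]⊕y)) ⟩
    ¬ x ⊕ z                    ≡⟨ x≤z ⟩
    𝟙                          ∎
    where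
    z≡[z⊖y]⊕y : z ≡ z ⊖ y ⊕ y
    z≡[z⊖y]⊕y = sym (trans (∨-comm z y) (x≤y⇒x∨y≡y y≤z))
    ¬[x∨y]⊕y≡¬x⊕y : ¬ (x ∨ y) ⊕ y ≡ ¬ x ⊕ y
    ¬[x∨y]⊕y≡¬x⊕y = begin
      (¬ x ⊕ y) ⊖ y ⊕ y              ≡⟨ łukasiewicz (¬ x ⊕ y) y ⟩
      y ⊖ (¬ x ⊕ y) ⊕ (¬ x ⊕ y)      ≡⟨ cong (λ t → ¬ t ⊕ (¬ x ⊕ y)) (¬y⊕[¬x⊕y]≡𝟙) ⟩
      ¬ 𝟙 ⊕ (¬ x ⊕ y)                ≡⟨ cong (_⊕ (¬ x ⊕ y)) ¬𝟙 ⟩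
      𝟘 ⊕ (¬ x ⊕ y)                  ≡⟨ ⊕-identityˡ _ ⟩
      ¬ x ⊕ y                        ∎
      where
      ¬y⊕[¬x⊕y]≡𝟙 : ¬ y ⊕ (¬ x ⊕ y) ≡ 𝟙
      ¬y⊕[¬x⊕y]≡𝟙 = trans (x∙yz≈y∙xz (¬ y) (¬ x) y) (trans (cong (¬ x ⊕_) (¬x⊕x≡𝟙 y)) (⊕-zeroʳ (¬ x)))

  x∧y≤x : ∀ x y → x ∧ y ≤ x
  x∧y≤x x y = ¬-cancel-≤ (subst (¬ x ≤_) (sym (¬-involutive _)) (x≤x∨y (¬ x) (¬ y)))

  x∧y≤y : ∀ x y → x ∧ y ≤ y
  x∧y≤y x y = ¬-cancel-≤ (subst (¬ y ≤_) (sym (¬-involutive _)) (y≤x∨y (¬ x) (¬ y)))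

  ∧-greatest : ∀ {x y z} → x ≤ y → x ≤ z → x ≤ y ∧ z
  ∧-greatest x≤y x≤z = ¬-cancel-≤ (subst (_≤ _) (sym (¬-involutive _)) (∨-least (¬-mono-≤ x≤y) (¬-mono-≤ x≤z)))

  x≤y⇒x∧y≡x : ∀ {x y} → x ≤ y → x ∧ y ≡ x
  x≤y⇒x∧y≡x {x} x≤y = ≤-antisym (x∧y≤x _ _) (∧-greatest (≤-reflexive refl) x≤y)

  x∧y≡x⇒x≤y : ∀ {x y} → x ∧ y ≡ x → x ≤ y
  x∧y≡x⇒x≤y {x} {y} e = subst (_≤ y) e (x∧y≤y x y)

  ⊕-monoˡ-≤ : ∀ {x x′} z → x ≤ x′ → x ⊕ z ≤ x′ ⊕ z
  ⊕-monoˡ-≤ {x} {x′} z x≤x′ = subst (x ⊕ z ≤_) (sym x′⊕z≡x⊕z⊕w) (x≤x⊕y (x ⊕ z) (x′ ⊖ x))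
    where
    x′⊕z≡x⊕z⊕w : x′ ⊕ z ≡ x ⊕ z ⊕ x′ ⊖ x
    x′⊕z≡x⊕z⊕w = begin
      x′ ⊕ z              ≡⟨ cong (_⊕ z) (x≤y⇒y≡x⊕[y⊖x] x≤x′) ⟩
      x ⊕ x′ ⊖ x ⊕ z      ≡⟨ ⊕-assoc _ _ _ ⟩
      x ⊕ (x′ ⊖ x ⊕ z)    ≡⟨ cong (x ⊕_) (⊕-comm _ z) ⟩
      x ⊕ (z ⊕ x′ ⊖ x)    ≡⟨ ⊕-assoc _ _ _ ⟨
      x ⊕ z ⊕ x′ ⊖ x      ∎

  ⊕-mono-≤ : ∀ {x x′ y y′} → x ≤ x′ → y ≤ y′ → x ⊕ y ≤ x′ ⊕ y′
  ⊕-mono-≤ {x} {x′} {y} {y′} x≤x′ y≤y′ =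
    ≤-trans (⊕-monoˡ-≤ y x≤x′) (subst₂ _≤_ (⊕-comm y x′) (⊕-comm y′ x′) (⊕-monoˡ-≤ x′ y≤y′))

  ⊙-mono-≤ : ∀ {x x′ y y′} → x ≤ x′ → y ≤ y′ → x ⊙ y ≤ x′ ⊙ y′
  ⊙-mono-≤ x≤x′ y≤y′ = ¬-mono-≤ (⊕-mono-≤ (¬-mono-≤ x≤x′) (¬-mono-≤ y≤y′))

  x⊙y≤y : ∀ x y → x ⊙ y ≤ y
  x⊙y≤y x y = begin
    ¬ (x ⊙ y) ⊕ y      ≡⟨ cong (_⊕ y) (¬-involutive _) ⟩
    ¬ x ⊕ ¬ y ⊕ y      ≡⟨ ⊕-assoc _ _ _ ⟩
    ¬ x ⊕ (¬ y ⊕ y)    ≡⟨ cong (¬ x ⊕_) (¬x⊕x≡𝟙 y) ⟩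
    ¬ x ⊕ 𝟙            ≡⟨ ⊕-zeroʳ _ ⟩
    𝟙                  ∎

  x⊙y≤x : ∀ x y → x ⊙ y ≤ x
  x⊙y≤x x y = subst (_≤ x) (⊙-comm y x) (x⊙y≤y y x)

  x⊙y≡𝟙⇒x≡𝟙 : ∀ {x y} → x ⊙ y ≡ 𝟙 → x ≡ 𝟙
  x⊙y≡𝟙⇒x≡𝟙 {x} {y} e = ≤-antisym (x≤𝟙 x) (subst (_≤ x) e (x⊙y≤x x y))

  -- x ⊙ y ≤ z and y ≤ ¬ x ⊕ z unfold to the two sides of this equation.
  ¬[x⊙y]⊕z≡¬y⊕[¬x⊕z] : ∀ x y z → ¬ (x ⊙ y) ⊕ z ≡ ¬ y ⊕ (¬ x ⊕ z)
  ¬[x⊙y]⊕z≡¬y⊕[¬x⊕z] x y z = begin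
    ¬ (x ⊙ y) ⊕ z      ≡⟨ cong (_⊕ z) (¬-involutive _) ⟩
    ¬ x ⊕ ¬ y ⊕ z      ≡⟨ ⊕-assoc _ _ _ ⟩
    ¬ x ⊕ (¬ y ⊕ z)    ≡⟨ x∙yz≈y∙xz _ _ _ ⟩
    ¬ y ⊕ (¬ x ⊕ z)    ∎

  ⊙-distribˡ-∨-≤ : ∀ w x y → w ⊙ (x ∨ y) ≤ w ⊙ x ∨ w ⊙ y
  ⊙-distribˡ-∨-≤ w x y =
    trans (¬[x⊙y]⊕z≡¬y⊕[¬x⊕z] w (x ∨ y) _) (∨-least (residual (x≤x∨y _ _)) (residual (y≤x∨y _ _)))
    where
    residual : ∀ {v z} → w ⊙ v ≤ z → v ≤ ¬ w ⊕ z
    residual {v} {z} h = trans (sym (¬[x⊙y]⊕z≡¬y⊕[¬x⊕z] w v z)) h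

  lattice : Order.Lattice _ _ _
  lattice = record
    { isLattice = record
      { isPartialOrder = ≤-isPartialOrder
      ; supremum       = λ x y → x≤x∨y x y , y≤x∨y x y , λ _ → ∨-least
      ; infimum        = λ x y → x∧y≤x x y , x∧y≤y x y , λ _ → ∧-greatest
      }
    }

  open JoinSemilatticeProperties (Order.Lattice.joinSemilattice lattice) public
    using () renaming (∨-monotonic to ∨-mono-≤)
  open MeetSemilatticeProperties (Order.Lattice.meetSemilattice lattice) public
    using () renaming (∧-monotonic to ∧-mono-≤)

  [x⊕y]⊖y≡x∧¬y : ∀ x y → (x ⊕ y) ⊖ y ≡ x ∧ ¬ y
  [x⊕y]⊖y≡x∧¬y x y = sym (cong₂ (λ s t → ¬ (¬ (s ⊕ t) ⊕ t)) (¬-involutive x) (¬-involutive y))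

  x⊖y≤¬y : ∀ x y → x ⊖ y ≤ ¬ y
  x⊖y≤¬y x y = begin
    ¬ (x ⊖ y) ⊕ ¬ y      ≡⟨ cong (_⊕ ¬ y) (¬-involutive _) ⟩
    ¬ x ⊕ y ⊕ ¬ y        ≡⟨ ⊕-assoc _ _ _ ⟩
    ¬ x ⊕ (y ⊕ ¬ y)      ≡⟨ cong (¬ x ⊕_) (trans (⊕-comm y (¬ y)) (¬x⊕x≡𝟙 y)) ⟩
    ¬ x ⊕ 𝟙              ≡⟨ ⊕-zeroʳ _ ⟩
    𝟙                    ∎

  [x∨y]⊖y≡x⊖y : ∀ x y → (x ∨ y) ⊖ y ≡ x ⊖ y
  [x∨y]⊖y≡x⊖y x y = trans ([x⊕y]⊖y≡x∧¬y (x ⊖ y) y) (x≤y⇒x∧y≡x (x⊖y≤¬y x y))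

  ¬x⊕[x⊖y]≡¬y∨¬x : ∀ x y → ¬ x ⊕ x ⊖ y ≡ ¬ y ∨ ¬ x
  ¬x⊕[x⊖y]≡¬y∨¬x x y = trans (⊕-comm _ _) (cong (λ t → ¬ t ⊕ ¬ x) (begin
    ¬ x ⊕ y        ≡⟨ ⊕-comm _ _ ⟩
    y ⊕ ¬ x        ≡⟨ cong (_⊕ ¬ x) (¬-involutive y) ⟨
    ¬ ¬ y ⊕ ¬ x    ∎))

  x≤y⇒¬y⊕x≡¬y⇒x≡𝟘 : ∀ {x y} → x ≤ y → ¬ y ⊕ x ≡ ¬ y → x ≡ 𝟘
  x≤y⇒¬y⊕x≡¬y⇒x≡𝟘 {x} {y} x≤y e = begin
    x                ≡⟨ x≤y⇒x∧y≡x x≤y ⟨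
    x ∧ y            ≡⟨ x∧y≡y⊙[¬y⊕x] x y ⟩
    y ⊙ (¬ y ⊕ x)    ≡⟨ cong (y ⊙_) e ⟩
    y ⊙ ¬ y          ≡⟨ x⊙¬x≡𝟘 y ⟩
    𝟘                ∎

  -- With m = x ∨ y, the meet z lies below both m ⊖ x and m ⊖ y, so ¬ m ⊕ z lies below
  -- ¬ x ∧ ¬ y = ¬ m; as z ≤ m, this forces z = 𝟘.
  x⊖y∧y⊖x≡𝟘 : ∀ x y → x ⊖ y ∧ y ⊖ x ≡ 𝟘
  x⊖y∧y⊖x≡𝟘 x y = x≤y⇒¬y⊕x≡¬y⇒x≡𝟘 z≤m (≤-antisym ¬m⊕z≤¬m (x≤x⊕y (¬ m) z))
    where
    z = x ⊖ y ∧ y ⊖ x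
    m = x ∨ y
    z≤m : z ≤ m
    z≤m = ≤-trans (x∧y≤x _ _) (x≤x⊕y (x ⊖ y) y)
    bound : ∀ {u} → u ≤ m → z ≤ m ⊖ u → ¬ m ⊕ z ≤ ¬ u
    bound {u} u≤m z≤m⊖u = ≤-trans (⊕-mono-≤ (≤-reflexive refl) z≤m⊖u)
      (≤-reflexive (trans (¬x⊕[x⊖y]≡¬y∨¬x m u) (trans (∨-comm _ _) (x≤y⇒x∨y≡y (¬-mono-≤ u≤m)))))
    ¬m⊕z≤¬y : ¬ m ⊕ z ≤ ¬ y
    ¬m⊕z≤¬y = bound (y≤x∨y x y) (subst (z ≤_) (sym ([x∨y]⊖y≡x⊖y x y)) (x∧y≤x _ _))
    ¬m⊕z≤¬x : ¬ m ⊕ z ≤ ¬ x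
    ¬m⊕z≤¬x = bound (x≤x∨y x y)
      (subst (z ≤_) (sym (trans (cong (_⊖ x) (∨-comm x y)) ([x∨y]⊖y≡x⊖y y x))) (x∧y≤y _ _))
    ¬m⊕z≤¬m : ¬ m ⊕ z ≤ ¬ m
    ¬m⊕z≤¬m = subst (¬ m ⊕ z ≤_) (sym (¬-∨ x y)) (∧-greatest ¬m⊕z≤¬x ¬m⊕z≤¬y)

  prelinearity : ∀ x y → (¬ x ⊕ y) ∨ (¬ y ⊕ x) ≡ 𝟙
  prelinearity x y = ¬-injective (trans (¬-∨ _ _) (trans (x⊖y∧y⊖x≡𝟘 x y) (sym ¬𝟙)))

  [x∨y]⊙[¬x⊕y]≤y : ∀ x y → (x ∨ y) ⊙ (¬ x ⊕ y) ≤ y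
  [x∨y]⊙[¬x⊕y]≤y x y = subst (_≤ y) (⊙-comm p (x ∨ y))
    (≤-trans (⊙-distribˡ-∨-≤ p x y) (∨-least p⊙x≤y (x⊙y≤y p y)))
    where
    p = ¬ x ⊕ y
    p⊙x≤y : p ⊙ x ≤ y
    p⊙x≤y = subst (_≤ y) (trans (x∧y≡y⊙[¬y⊕x] y x) (⊙-comm x p)) (x∧y≤x y x)

  -- w = w ⊙ (p ∨ q) by prelinearity, and each of w ⊙ p, w ⊙ q lies below the right-hand side.
  ∧-distribˡ-∨ : ∀ x y z → x ∧ (y ∨ z) ≡ x ∧ y ∨ x ∧ z
  ∧-distribˡ-∨ x y z = ≤-antisym w≤x∧y∨x∧z
    (∨-least (∧-mono-≤ (≤-reflexive refl) (x≤x∨y y z)) (∧-mono-≤ (≤-reflexive refl) (y≤x∨y y z)))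
    where
    w = x ∧ (y ∨ z)
    p = ¬ y ⊕ z
    q = ¬ z ⊕ y
    bound : ∀ {u v} → w ≤ u ∨ v → w ⊙ (¬ u ⊕ v) ≤ x ∧ v
    bound {u} {v} w≤u∨v = ∧-greatest (≤-trans (x⊙y≤x w _) (x∧y≤x x _))
      (≤-trans (⊙-mono-≤ w≤u∨v (≤-reflexive refl)) ([x∨y]⊙[¬x⊕y]≤y u v))
    w⊙p∨w⊙q≤x∧y∨x∧z : w ⊙ p ∨ w ⊙ q ≤ x ∧ y ∨ x ∧ z
    w⊙p∨w⊙q≤x∧y∨x∧z = subst (w ⊙ p ∨ w ⊙ q ≤_) (∨-comm _ _)
      (∨-mono-≤ (bound (x∧y≤y x _)) (bound (subst (w ≤_) (∨-comm y z) (x∧y≤y x _))))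
    w⊙[p∨q]≡w : w ⊙ (p ∨ q) ≡ w
    w⊙[p∨q]≡w = trans (cong (w ⊙_) (prelinearity y z)) (⊙-identityʳ w)
    w≤x∧y∨x∧z : w ≤ x ∧ y ∨ x ∧ z
    w≤x∧y∨x∧z = subst (_≤ x ∧ y ∨ x ∧ z) w⊙[p∨q]≡w (≤-trans (⊙-distribˡ-∨-≤ w p q) w⊙p∨w⊙q≤x∧y∨x∧z)

  distributiveLattice : Order.DistributiveLattice _ _ _
  distributiveLattice = record
    { isDistributiveLattice = record
      { isLattice    = Order.Lattice.isLattice lattice
      ; ∧-distribˡ-∨ = ∧-distribˡ-∨
      }
    }

module IMVAlgebraProperties (J : IMVAlgebra) where
  open IMVAlgebra J
  open IMV J
  open ≡-Reasoning

  ¬𝟙 : ¬ 𝟙 ≡ 𝟘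
  ¬𝟙 = trans (cong ¬_ 𝟙-def) (¬¬ 𝟘)

  ¬-⊙ : ∀ x y → ¬ (x ⊙ y) ≡ (¬ x) ⊕ (¬ y)
  ¬-⊙ x y = trans (cong ¬_ (⊙-def x y)) (¬¬ _)

  ¬-⊕ : ∀ x y → ¬ (x ⊕ y) ≡ (¬ x) ⊙ (¬ y)
  ¬-⊕ x y = sym (trans (⊙-def _ _) (cong₂ (λ s t → ¬ (s ⊕ t)) (¬¬ x) (¬¬ y)))

  ⊙-zeroˡ : ∀ x → 𝟘 ⊙ x ≡ 𝟘
  ⊙-zeroˡ x = trans (⊙-def _ _) (trans (cong ¬_ (trans (⊕-comm _ _) (⊕-abs _))) (¬¬ 𝟘))

  ⊙-zeroʳ : ∀ x → x ⊙ 𝟘 ≡ 𝟘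
  ⊙-zeroʳ x = trans (⊙-def _ _) (trans (cong ¬_ (⊕-abs _)) (¬¬ 𝟘))

  ⊙-identityˡ : ∀ x → 𝟙 ⊙ x ≡ x
  ⊙-identityˡ x = trans (⊙-def _ _) (trans (cong (λ t → ¬ (t ⊕ (¬ x))) ¬𝟙)
    (trans (cong ¬_ (trans (⊕-comm _ _) (⊕-zero _))) (¬¬ x)))

  ⊙-assoc : ∀ x y z → (x ⊙ y) ⊙ z ≡ x ⊙ (y ⊙ z)
  ⊙-assoc x y z = begin
    (x ⊙ y) ⊙ z                    ≡⟨ ⊙-def _ _ ⟩
    ¬ ((¬ (x ⊙ y)) ⊕ (¬ z))        ≡⟨ cong (λ t → ¬ (t ⊕ (¬ z))) (¬-⊙ x y) ⟩
    ¬ (((¬ x) ⊕ (¬ y)) ⊕ (¬ z))    ≡⟨ cong ¬_ (⊕-assoc _ _ _) ⟨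
    ¬ ((¬ x) ⊕ ((¬ y) ⊕ (¬ z)))    ≡⟨ cong (λ t → ¬ ((¬ x) ⊕ t)) (¬-⊙ y z) ⟨
    ¬ ((¬ x) ⊕ (¬ (y ⊙ z)))        ≡⟨ ⊙-def _ _ ⟨
    x ⊙ (y ⊙ z)                    ∎

  Δ¬ : ∀ x → Δ (¬ x) ≡ ¬ (∇ x)
  Δ¬ x = trans (sym (¬¬ _)) (cong ¬_ (sym (∇-def x)))

  ∇¬ : ∀ x → ∇ (¬ x) ≡ ¬ (Δ x)
  ∇¬ x = trans (∇-def (¬ x)) (cong (λ t → ¬ (Δ t)) (¬¬ x))

  ∇⊕ : ∀ x y → ∇ (x ⊕ y) ≡ ∇ x ⊕ ∇ y
  ∇⊕ x y = begin
    ∇ (x ⊕ y)                    ≡⟨ ∇-def _ ⟩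
    ¬ (Δ (¬ (x ⊕ y)))            ≡⟨ cong (λ t → ¬ (Δ t)) (¬-⊕ x y) ⟩
    ¬ (Δ ((¬ x) ⊙ (¬ y)))        ≡⟨ cong ¬_ (Δ⊙ _ _) ⟩
    ¬ (Δ (¬ x) ⊙ Δ (¬ y))        ≡⟨ cong₂ (λ s t → ¬ (s ⊙ t)) (Δ¬ x) (Δ¬ y) ⟩
    ¬ ((¬ (∇ x)) ⊙ (¬ (∇ y)))    ≡⟨ cong ¬_ (¬-⊕ _ _) ⟨
    ¬ (¬ (∇ x ⊕ ∇ y))            ≡⟨ ¬¬ _ ⟩
    ∇ x ⊕ ∇ y                    ∎

  ∇⊙ : ∀ x y → ∇ (x ⊙ y) ≡ ∇ x ⊙ ∇ y
  ∇⊙ x y = begin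
    ∇ (x ⊙ y)                    ≡⟨ ∇-def _ ⟩
    ¬ (Δ (¬ (x ⊙ y)))            ≡⟨ cong (λ t → ¬ (Δ t)) (¬-⊙ x y) ⟩
    ¬ (Δ ((¬ x) ⊕ (¬ y)))        ≡⟨ cong ¬_ (Δ⊕ _ _) ⟩
    ¬ (Δ (¬ x) ⊕ Δ (¬ y))        ≡⟨ cong₂ (λ s t → ¬ (s ⊕ t)) (Δ¬ x) (Δ¬ y) ⟩
    ¬ ((¬ (∇ x)) ⊕ (¬ (∇ y)))    ≡⟨ ⊙-def _ _ ⟨
    ∇ x ⊙ ∇ y                    ∎

  ∇Δ : ∀ x → ∇ (Δ x) ≡ Δ x
  ∇Δ x = begin
    ∇ (Δ x)            ≡⟨ ∇-def _ ⟩
    ¬ (Δ (¬ (Δ x)))    ≡⟨ cong (λ t → ¬ (Δ t)) (∇¬ x) ⟨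
    ¬ (Δ (∇ (¬ x)))    ≡⟨ cong ¬_ (Δ∇ _) ⟩
    ¬ (∇ (¬ x))        ≡⟨ cong ¬_ (∇¬ x) ⟩
    ¬ (¬ (Δ x))        ≡⟨ ¬¬ _ ⟩
    Δ x                ∎

  ∇∇ : ∀ x → ∇ (∇ x) ≡ ∇ x
  ∇∇ x = begin
    ∇ (∇ x)            ≡⟨ ∇-def _ ⟩
    ¬ (Δ (¬ (∇ x)))    ≡⟨ cong (λ t → ¬ (Δ t)) (Δ¬ x) ⟨
    ¬ (Δ (Δ (¬ x)))    ≡⟨ cong ¬_ (ΔΔ _) ⟩
    ¬ (Δ (¬ x))        ≡⟨ ∇-def x ⟨
    ∇ x                ∎

  ∇ι : ∇ ι ≡ 𝟙
  ∇ι = trans (∇-def ι) (trans (cong (λ t → ¬ (Δ t)) ¬ι) (trans (cong ¬_ Δι) (sym 𝟙-def)))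

  ∇𝟘 : ∇ 𝟘 ≡ 𝟘
  ∇𝟘 = trans (∇-def 𝟘) (trans (cong (λ t → ¬ (Δ t)) (sym 𝟙-def)) (trans (cong ¬_ Δ𝟙) ¬𝟙))

  ∇𝟙 : ∇ 𝟙 ≡ 𝟙
  ∇𝟙 = trans (∇-def 𝟙) (trans (cong (λ t → ¬ (Δ t)) ¬𝟙) (trans (cong ¬_ Δ𝟘) (sym 𝟙-def)))

  Δ∇-injective : ∀ {x y} → Δ x ≡ Δ y → ∇ x ≡ ∇ y → x ≡ y
  Δ∇-injective {x} {y} Δx≡Δy ∇x≡∇y =
    trans (sym (decomp x)) (trans (cong₂ (λ s t → s ⊕ ((ι ⊙ t) ⊙ (¬ s))) Δx≡Δy ∇x≡∇y) (decomp y))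

  γ≡-unique : ∀ {z z′ a b} → γ≡ z a b → γ≡ z′ a b → z ≡ z′
  γ≡-unique (Δz≡a , ∇z≡b) (Δz′≡a , ∇z′≡b) = Δ∇-injective (trans Δz≡a (sym Δz′≡a)) (trans ∇z≡b (sym ∇z′≡b))

  central⇒Δ≡ : ∀ {u} → InCenter u → Δ u ≡ u
  central⇒Δ≡ {u} Δu≡∇u = begin
    Δ u                                ≡⟨ ⊕-zero _ ⟨
    Δ u ⊕ 𝟘                            ≡⟨ cong (Δ u ⊕_) ι⊙∇u⊙¬Δu≡𝟘 ⟨
    Δ u ⊕ ((ι ⊙ ∇ u) ⊙ (¬ (Δ u)))      ≡⟨ decomp u ⟩
    u                                  ∎
    where
    ι⊙∇u⊙¬Δu≡𝟘 : (ι ⊙ ∇ u) ⊙ (¬ (Δ u)) ≡ 𝟘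
    ι⊙∇u⊙¬Δu≡𝟘 = trans (⊙-assoc _ _ _)
      (trans (cong (ι ⊙_) (trans (cong₂ (λ s t → s ⊙ (¬ t)) (sym Δu≡∇u) Δu≡∇u) (Δ⊙¬∇ u))) (⊙-zeroʳ ι))

  central⇒∇≡ : ∀ {u} → InCenter u → ∇ u ≡ u
  central⇒∇≡ Δu≡∇u = trans (sym Δu≡∇u) (central⇒Δ≡ Δu≡∇u)

  Δ-central : ∀ x → InCenter (Δ x)
  Δ-central x = trans (ΔΔ x) (sym (∇Δ x))

  ∇-central : ∀ x → InCenter (∇ x)
  ∇-central x = trans (Δ∇ x) (sym (∇∇ x))

  Centre : Set
  Centre = Σ Carrier InCenter

  Centre-≡ : {a b : Centre} → proj₁ a ≡ proj₁ b → a ≡ b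
  Centre-≡ {u , p} {.u , q} refl = cong (u ,_) (uip p q)

  -- Central elements are fixed by Δ, so the axiom luk of J (stated for Δ-images) applies to them.
  centre : MVAlgebra
  centre = record
    { Carrier      = Centre
    ; 𝟘            = 𝟘 , trans Δ𝟘 (sym ∇𝟘)
    ; ¬_           = λ (u , p) → ¬ u , trans (Δ¬ u) (trans (cong ¬_ (sym p)) (sym (∇¬ u)))
    ; _⊕_          = λ (u , p) (v , q) → u ⊕ v , trans (Δ⊕ u v) (trans (cong₂ _⊕_ p q) (sym (∇⊕ u v)))
    ; ⊕-assoc      = λ _ _ _ → Centre-≡ (sym (⊕-assoc _ _ _))
    ; ⊕-comm       = λ _ _ → Centre-≡ (⊕-comm _ _)
    ; ⊕-identityʳ  = λ _ → Centre-≡ (⊕-zero _)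
    ; ⊕-zeroʳ      = λ _ → Centre-≡ (⊕-abs _)
    ; ¬-involutive = λ _ → Centre-≡ (¬¬ _)
    ; łukasiewicz  = λ (u , p) (v , q) → Centre-≡ (begin
        ¬ ((¬ u) ⊕ v) ⊕ v                  ≡⟨ cong₂ (λ s t → ¬ ((¬ s) ⊕ t) ⊕ t) (central⇒Δ≡ p) (central⇒Δ≡ q) ⟨
        ¬ ((¬ (Δ u)) ⊕ Δ v) ⊕ Δ v          ≡⟨ luk u v ⟩
        ¬ ((¬ (Δ v)) ⊕ Δ u) ⊕ Δ u          ≡⟨ cong₂ (λ s t → ¬ ((¬ s) ⊕ t) ⊕ t) (central⇒Δ≡ q) (central⇒Δ≡ p) ⟩
        ¬ ((¬ v) ⊕ u) ⊕ u                  ∎)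
    }

  module 𝒞 = MVAlgebraProperties centre
  open 𝒞 using (_≤_; _∨_; _∧_)

  Δᶜ ∇ᶜ : Carrier → Centre
  Δᶜ x = Δ x , Δ-central x
  ∇ᶜ x = ∇ x , ∇-central x

  Δᶜ-central : ∀ {u} (p : InCenter u) → Δᶜ u ≡ (u , p)
  Δᶜ-central p = Centre-≡ (central⇒Δ≡ p)

  ∇ᶜ-central : ∀ {u} (p : InCenter u) → ∇ᶜ u ≡ (u , p)
  ∇ᶜ-central p = Centre-≡ (central⇒∇≡ p)

  Δᶜ≤∇ᶜ : ∀ x → Δᶜ x ≤ ∇ᶜ x
  Δᶜ≤∇ᶜ x = Centre-≡ (begin
    (¬ (Δ x)) ⊕ ∇ x              ≡⟨ cong ((¬ (Δ x)) ⊕_) (¬¬ (∇ x)) ⟨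
    (¬ (Δ x)) ⊕ (¬ (¬ (∇ x)))    ≡⟨ ¬-⊙ _ _ ⟨
    ¬ (Δ x ⊙ (¬ (∇ x)))          ≡⟨ cong ¬_ (Δ⊙¬∇ x) ⟩
    ¬ 𝟘                          ∎)

  Δζ : ∀ u v → Δ (ζ u v) ≡ Δ u
  Δζ u v = begin
    Δ (Δ u ⊕ ((ι ⊙ ∇ v) ⊙ (¬ (Δ u))))            ≡⟨ Δ⊕ _ _ ⟩
    Δ (Δ u) ⊕ Δ ((ι ⊙ ∇ v) ⊙ (¬ (Δ u)))          ≡⟨ cong₂ _⊕_ (ΔΔ u) (Δ⊙ _ _) ⟩
    Δ u ⊕ (Δ (ι ⊙ ∇ v) ⊙ Δ (¬ (Δ u)))            ≡⟨ cong (λ t → Δ u ⊕ (t ⊙ Δ (¬ (Δ u)))) Δ[ι⊙∇v]≡𝟘 ⟩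
    Δ u ⊕ (𝟘 ⊙ Δ (¬ (Δ u)))                      ≡⟨ cong (Δ u ⊕_) (⊙-zeroˡ _) ⟩
    Δ u ⊕ 𝟘                                      ≡⟨ ⊕-zero _ ⟩
    Δ u                                          ∎
    where
    Δ[ι⊙∇v]≡𝟘 : Δ (ι ⊙ ∇ v) ≡ 𝟘
    Δ[ι⊙∇v]≡𝟘 = trans (Δ⊙ _ _) (trans (cong (_⊙ Δ (∇ v)) Δι) (⊙-zeroˡ _))

  ∇ζ : ∀ u v → ∇ (ζ u v) ≡ ∇ v ∨ᶜ Δ u
  ∇ζ u v = begin
    ∇ (Δ u ⊕ ((ι ⊙ ∇ v) ⊙ (¬ (Δ u))))            ≡⟨ ∇⊕ _ _ ⟩
    ∇ (Δ u) ⊕ ∇ ((ι ⊙ ∇ v) ⊙ (¬ (Δ u)))          ≡⟨ cong₂ _⊕_ (∇Δ u) (∇⊙ _ _) ⟩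
    Δ u ⊕ (∇ (ι ⊙ ∇ v) ⊙ ∇ (¬ (Δ u)))            ≡⟨ cong₂ (λ s t → Δ u ⊕ (s ⊙ t)) ∇[ι⊙∇v]≡∇v ∇¬Δu≡¬Δu ⟩
    Δ u ⊕ (∇ v ⊙ (¬ (Δ u)))                      ≡⟨ cong (Δ u ⊕_) (⊙-def _ _) ⟩
    Δ u ⊕ ¬ ((¬ (∇ v)) ⊕ (¬ (¬ (Δ u))))          ≡⟨ cong (λ t → Δ u ⊕ ¬ ((¬ (∇ v)) ⊕ t)) (¬¬ (Δ u)) ⟩
    Δ u ⊕ ¬ ((¬ (∇ v)) ⊕ Δ u)                    ≡⟨ ⊕-comm _ _ ⟩
    ∇ v ∨ᶜ Δ u                                   ∎
    where
    ∇[ι⊙∇v]≡∇v : ∇ (ι ⊙ ∇ v) ≡ ∇ v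
    ∇[ι⊙∇v]≡∇v = trans (∇⊙ _ _) (trans (cong₂ _⊙_ ∇ι (∇∇ v)) (⊙-identityˡ _))
    ∇¬Δu≡¬Δu : ∇ (¬ (Δ u)) ≡ ¬ (Δ u)
    ∇¬Δu≡¬Δu = trans (∇¬ _) (cong ¬_ (ΔΔ u))

  ζ-γ≡ : (a b : Centre) → a ≤ b → γ≡ (ζ (proj₁ a) (proj₁ b)) (proj₁ a) (proj₁ b)
  ζ-γ≡ a@(u , p) b@(v , q) a≤b = trans (Δζ u v) (central⇒Δ≡ p) , trans (∇ζ u v) (cong proj₁ (begin
    ∇ᶜ v ∨ Δᶜ u    ≡⟨ cong₂ _∨_ (∇ᶜ-central q) (Δᶜ-central p) ⟩
    b ∨ a          ≡⟨ 𝒞.∨-comm b a ⟩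
    a ∨ b          ≡⟨ 𝒞.x≤y⇒x∨y≡y a≤b ⟩
    b              ∎))

  𝐰≡∧ᶜ : ∀ u v → u 𝐰 v ≡ u ∧ᶜ v
  𝐰≡∧ᶜ u v = trans (⊙-def _ _) (cong (λ t → ¬ (t ⊕ (¬ v))) (trans (¬¬ _) (⊙-def (¬ u) v)))

  infix 4 _≼_
  _≼_ : Carrier → Carrier → Set
  x ≼ y = Δᶜ x ≤ Δᶜ y × ∇ᶜ x ≤ ∇ᶜ y

  ≼-mono₂ : (f : Carrier → Carrier → Carrier) (g : Centre → Centre → Centre) →
    (∀ x y → Δᶜ (f x y) ≡ g (Δᶜ x) (Δᶜ y)) → (∀ x y → ∇ᶜ (f x y) ≡ g (∇ᶜ x) (∇ᶜ y)) →
    (∀ {a a′ b b′} → a ≤ a′ → b ≤ b′ → g a b ≤ g a′ b′) →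
    ∀ {x x′ y y′} → x ≼ x′ → y ≼ y′ → f x y ≼ f x′ y′
  ≼-mono₂ f g Δ-homo ∇-homo g-mono (Δx≤Δx′ , ∇x≤∇x′) (Δy≤Δy′ , ∇y≤∇y′) =
    subst₂ _≤_ (sym (Δ-homo _ _)) (sym (Δ-homo _ _)) (g-mono Δx≤Δx′ Δy≤Δy′) ,
    subst₂ _≤_ (sym (∇-homo _ _)) (sym (∇-homo _ _)) (g-mono ∇x≤∇x′ ∇y≤∇y′)

  ⊕-mono-≼ : ∀ {x x′ y y′} → x ≼ x′ → y ≼ y′ → x ⊕ y ≼ x′ ⊕ y′
  ⊕-mono-≼ = ≼-mono₂ _⊕_ 𝒞._⊕_ (λ x y → Centre-≡ (Δ⊕ x y)) (λ x y → Centre-≡ (∇⊕ x y)) 𝒞.⊕-mono-≤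

  ⊙-mono-≼ : ∀ {x x′ y y′} → x ≼ x′ → y ≼ y′ → x ⊙ y ≼ x′ ⊙ y′
  ⊙-mono-≼ = ≼-mono₂ _⊙_ 𝒞._⊙_ (λ x y → Centre-≡ (trans (Δ⊙ x y) (⊙-def _ _)))
    (λ x y → Centre-≡ (trans (∇⊙ x y) (⊙-def _ _))) 𝒞.⊙-mono-≤

  ¬-anti-≼ : ∀ {x y} → x ≼ y → ¬ y ≼ ¬ x
  ¬-anti-≼ {x} {y} (Δx≤Δy , ∇x≤∇y) =
    subst₂ _≤_ (Centre-≡ (sym (Δ¬ y))) (Centre-≡ (sym (Δ¬ x))) (𝒞.¬-mono-≤ ∇x≤∇y) ,
    subst₂ _≤_ (Centre-≡ (sym (∇¬ y))) (Centre-≡ (sym (∇¬ x))) (𝒞.¬-mono-≤ Δx≤Δy)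

  Δx≼x : ∀ x → Δ x ≼ x
  Δx≼x x = 𝒞.≤-reflexive (Centre-≡ (ΔΔ x)) , subst (_≤ ∇ᶜ x) (Centre-≡ (sym (∇Δ x))) (Δᶜ≤∇ᶜ x)

  x≼∇x : ∀ x → x ≼ ∇ x
  x≼∇x x = subst (Δᶜ x ≤_) (Centre-≡ (sym (Δ∇ x))) (Δᶜ≤∇ᶜ x) , 𝒞.≤-reflexive (Centre-≡ (sym (∇∇ x)))

  𝟘≼x : ∀ x → 𝟘 ≼ x
  𝟘≼x x = subst (_≤ Δᶜ x) (Centre-≡ (sym Δ𝟘)) (𝒞.𝟘≤x _) , subst (_≤ ∇ᶜ x) (Centre-≡ (sym ∇𝟘)) (𝒞.𝟘≤x _)

  x≼𝟙 : ∀ x → x ≼ 𝟙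
  x≼𝟙 x = subst (Δᶜ x ≤_) (Centre-≡ (sym (trans Δ𝟙 𝟙-def))) (𝒞.x≤𝟙 _) ,
          subst (∇ᶜ x ≤_) (Centre-≡ (sym (trans ∇𝟙 𝟙-def))) (𝒞.x≤𝟙 _)

  ≼⇔⊙≡𝟙 : ∀ {x y} → (x ≼ y) ⇔ ((((¬ (Δ x)) ⊕ Δ y) ⊙ ((¬ (∇ x)) ⊕ ∇ y)) ≡ 𝟙)
  ≼⇔⊙≡𝟙 {x} {y} = mk⇔
    (λ (Δx≤Δy , ∇x≤∇y) → trans (sym proj₁-centre-⊙)
      (trans (cong proj₁ (trans (cong₂ 𝒞._⊙_ Δx≤Δy ∇x≤∇y) (𝒞.⊙-identityʳ 𝒞.𝟙))) (sym 𝟙-def)))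
    (λ e → let E≡𝟙 = Centre-≡ (trans proj₁-centre-⊙ (trans e 𝟙-def))
           in 𝒞.x⊙y≡𝟙⇒x≡𝟙 E≡𝟙 , 𝒞.x⊙y≡𝟙⇒x≡𝟙 (trans (𝒞.⊙-comm _ _) E≡𝟙))
    where
    proj₁-centre-⊙ : proj₁ ((𝒞.¬ Δᶜ x 𝒞.⊕ Δᶜ y) 𝒞.⊙ (𝒞.¬ ∇ᶜ x 𝒞.⊕ ∇ᶜ y)) ≡ ((¬ (Δ x)) ⊕ Δ y) ⊙ ((¬ (∇ x)) ⊕ ∇ y)
    proj₁-centre-⊙ = sym (⊙-def _ _)

module IMVLattice (J : IMVAlgebra)
  (_⊓_ _⊔_ : IMVAlgebra.Carrier J → IMVAlgebra.Carrier J → IMVAlgebra.Carrier J)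
  (meet : IMV.IsMeetOp J _⊓_) (join : IMV.IsJoinOp J _⊔_) where
  open IMVAlgebra J
  open IMV J
  open IMVAlgebraProperties J
  open 𝒞 using (_∨_; _∧_)

  _⊑_ : Carrier → Carrier → Set
  x ⊑ y = x ⊓ y ≡ x

  -- γ_J, with values in pairs of central elements rather than in intervals.
  γ : Carrier → Centre × Centre
  γ x = Δᶜ x , ∇ᶜ x

  γ-isLatticeMonomorphism : IsLatticeMonomorphism
    (record { Carrier = Carrier ; _≈_ = _≡_ ; _∨_ = _⊔_ ; _∧_ = _⊓_ })
    (record { Carrier = Centre × Centre ; _≈_ = Pointwise _≡_ _≡_ ; _∨_ = zip′ _∨_ _∨_ ; _∧_ = zip′ _∧_ _∧_ })
    γ
  γ-isLatticeMonomorphism = record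
    { isLatticeHomomorphism = record
      { isRelHomomorphism = record { cong = λ { refl → refl , refl } }
      ; ∧-homo = λ x y → Centre-≡ (proj₁ (meet x y)) , Centre-≡ (proj₂ (meet x y))
      ; ∨-homo = λ x y → Centre-≡ (proj₁ (join x y)) , Centre-≡ (proj₂ (join x y))
      }
    ; injective = λ (Δx≡Δy , ∇x≡∇y) → Δ∇-injective (cong proj₁ Δx≡Δy) (cong proj₁ ∇x≡∇y)
    }

  ⊔-⊓-isDistributiveLattice : IsDistributiveLattice _≡_ _⊔_ _⊓_
  ⊔-⊓-isDistributiveLattice = LatticeMonomorphism.isDistributiveLattice γ-isLatticeMonomorphism
    (×-isDistributiveLattice centre-isDistributiveLattice centre-isDistributiveLattice)
    where centre-isDistributiveLattice = isAlgDistributiveLattice 𝒞.distributiveLattice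

  ⊑⇔≼ : ∀ {x y} → (x ⊑ y) ⇔ (x ≼ y)
  ⊑⇔≼ {x} {y} = mk⇔
    (λ x⊓y≡x → 𝒞.x∧y≡x⇒x≤y (Centre-≡ (trans (sym (proj₁ (meet x y))) (cong Δ x⊓y≡x))) ,
               𝒞.x∧y≡x⇒x≤y (Centre-≡ (trans (sym (proj₂ (meet x y))) (cong ∇ x⊓y≡x))))
    (λ (Δx≤Δy , ∇x≤∇y) → Δ∇-injective (trans (proj₁ (meet x y)) (cong proj₁ (𝒞.x≤y⇒x∧y≡x Δx≤Δy)))
                                       (trans (proj₂ (meet x y)) (cong proj₁ (𝒞.x≤y⇒x∧y≡x ∇x≤∇y))))

  ⊑⇒≼ : ∀ {x y} → x ⊑ y → x ≼ y
  ⊑⇒≼ = Equivalence.to ⊑⇔≼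

  ≼⇒⊑ : ∀ {x y} → x ≼ y → x ⊑ y
  ≼⇒⊑ = Equivalence.from ⊑⇔≼

  ⊑⇔⊔≡ : ∀ {x y} → (x ⊑ y) ⇔ (x ⊔ y ≡ y)
  ⊑⇔⊔≡ = ∧≡⇔∨≡ (IsDistributiveLattice.isLattice ⊔-⊓-isDistributiveLattice)

  central-⊑⇒γ≡ζ : ∀ {u v} → InCenter u → InCenter v → u ⊑ v → γ≡ (ζ u v) u v
  central-⊑⇒γ≡ζ {u} {v} p q u⊑v =
    ζ-γ≡ (u , p) (v , q) (subst₂ 𝒞._≤_ (∇ᶜ-central p) (∇ᶜ-central q) (proj₂ (⊑⇒≼ u⊑v)))

  ⊓≡ζ : ∀ x y → x ⊓ y ≡ ζ (Δ x 𝐰 Δ y) (∇ x 𝐰 ∇ y)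
  ⊓≡ζ x y = trans
    (γ≡-unique (meet x y) (ζ-γ≡ (Δᶜ x ∧ Δᶜ y) (∇ᶜ x ∧ ∇ᶜ y) (𝒞.∧-mono-≤ (Δᶜ≤∇ᶜ x) (Δᶜ≤∇ᶜ y))))
    (sym (cong₂ ζ (𝐰≡∧ᶜ (Δ x) (Δ y)) (𝐰≡∧ᶜ (∇ x) (∇ y))))

  ⊔≡ζ : ∀ x y → x ⊔ y ≡ ζ (Δ x 𝐯 Δ y) (∇ x 𝐯 ∇ y)
  ⊔≡ζ x y = γ≡-unique (join x y) (ζ-γ≡ (Δᶜ x ∨ Δᶜ y) (∇ᶜ x ∨ ∇ᶜ y) (𝒞.∨-mono-≤ (Δᶜ≤∇ᶜ x) (Δᶜ≤∇ᶜ y)))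

proposition5p3 : (J : IMVAlgebra) (_⊓_ _⊔_ : IMVAlgebra.Carrier J → IMVAlgebra.Carrier J → IMVAlgebra.Carrier J)
    → IMV.IsMeetOp J _⊓_ → IMV.IsJoinOp J _⊔_ → IMV.Prop53 J _⊓_ _⊔_
proposition5p3 J _⊓_ _⊔_ meet join = record
  { i-meet     = λ u v _ _ → 𝐰≡∧ᶜ u v
  ; i-join     = λ _ _ _ _ → refl
  ; ii-distrib = ⊔-⊓-isDistributiveLattice
  ; ii-top     = λ x → ≼⇒⊑ (x≼𝟙 x)
  ; ii-bot     = λ x → ≼⇒⊑ (𝟘≼x x)
  ; iii-⊕-mono = λ _ _ _ _ x⊑x′ y⊑y′ → ≼⇒⊑ (⊕-mono-≼ (⊑⇒≼ x⊑x′) (⊑⇒≼ y⊑y′))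
  ; iii-⊙-mono = λ _ _ _ _ x⊑x′ y⊑y′ → ≼⇒⊑ (⊙-mono-≼ (⊑⇒≼ x⊑x′) (⊑⇒≼ y⊑y′))
  ; iii-¬-anti = λ _ _ x⊑y → ≼⇒⊑ (¬-anti-≼ (⊑⇒≼ x⊑y))
  ; iii-Δ      = λ x → ≼⇒⊑ (Δx≼x x)
  ; iii-∇      = λ x → ≼⇒⊑ (x≼∇x x)
  ; iv         = λ _ _ → central-⊑⇒γ≡ζ
  ; v          = ⊓≡ζ
  ; vi         = ⊔≡ζ
  ; vii-1      = λ _ _ → ⊑⇔⊔≡
  ; vii-2      = λ _ _ → ≼⇔⊙≡𝟙 ⇔-∘ (⊑⇔≼ ⇔-∘ ⇔-sym ⊑⇔⊔≡)
  }
  where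
  open IMVAlgebraProperties J
  open IMVLattice J _⊓_ _⊔_ meet join
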